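{- If $G$ is a connected graph, then $\mathrm{gp}(G)\le 1+\min\{\ell(v):\ v \text{ is a gp-vertex of } G\}$.
   Context: For a connected graph $G$, a set $S\subseteq V(G)$ is a general position set if no three distinct vertices of $S$ lie on a common geodesic (shortest path) of $G$; $\mathrm{gp}(G)$ is the maximum cardinality of a general position set, a general position set of that cardinality is a gp-set, and a gp-vertex is a vertex lying in at least one gp-set. For a vertex $v$, $\ell(v)$ denotes the number of leaves of a breadth-first search tree of $G$ rooted at $v$. -}

module Defs where

open import Data.Nat using (ℕ; zero; suc; _≤_; _+_)
open import Data.Fin using (Fin; _≟_)
open import Data.Fin.Subset using (Subset; _∈_; ∣_∣)
open import Data.Bool using (Bool; not; _∧_)
open import Data.List using (List; length; filterᵇ; allFin)
open import Data.Bool.ListAction using (any)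
open import Data.Product using (Σ; _×_; ∃; ∃-syntax; _,_)
open import Relation.Nullary using (¬_; ⌊_⌋)
open import Relation.Binary.PropositionalEquality using (_≡_; _≢_)

record Graph (n : ℕ) : Set₁ where
  field
    Adj   : Fin n → Fin n → Set
    sym   : ∀ {u v} → Adj u v → Adj v u
    irrefl : ∀ {u} → ¬ Adj u u
open Graph public

module _ {n : ℕ} (G : Graph n) where

  data Walk : Fin n → Fin n → ℕ → Set where
    stop : ∀ {u} → Walk u u 0
    step : ∀ {u x w k} → Adj G u x → Walk x w k → Walk u w (suc k)

  data OnWalk (v : Fin n) : ∀ {u w k} → Walk u w k → Set where
    here  : ∀ {w k} {p : Walk v w k} → OnWalk v p
    there : ∀ {u x w k} {e : Adj G u x} {p : Walk x w k} → OnWalk v p → OnWalk v (step e p)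

  Connected : Set
  Connected = ∀ u w → ∃[ k ] Walk u w k

  Dist : Fin n → Fin n → ℕ → Set
  Dist u w k = Walk u w k × (∀ m → Walk u w m → k ≤ m)

  OnCommonGeodesic : Fin n → Fin n → Fin n → Set
  OnCommonGeodesic x y z =
    ∃[ a ] ∃[ b ] ∃[ k ] Σ (Walk a b k) λ p →
      Dist a b k × OnWalk x p × OnWalk y p × OnWalk z p

  GeneralPosition : Subset n → Set
  GeneralPosition S = ∀ x y z → x ∈ S → y ∈ S → z ∈ S →
    x ≢ y → y ≢ z → x ≢ z → ¬ OnCommonGeodesic x y z

  IsGpSet : Subset n → Set
  IsGpSet S = GeneralPosition S × (∀ T → GeneralPosition T → ∣ T ∣ ≤ ∣ S ∣)

  IsGpVertex : Fin n → Set
  IsGpVertex v = ∃[ S ] (IsGpSet S × v ∈ S)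

  -- A BFS tree rooted at r, given by its parent function: every non-root
  -- vertex u is joined (in G) to its parent, which is one step closer to r.
  -- These are exactly the spanning trees preserving distances from r.
  IsBFSTree : Fin n → (Fin n → Fin n) → Set
  IsBFSTree r par = ∀ u → u ≢ r →
    Adj G u (par u) × ∃[ k ] (Dist r u (suc k) × Dist r (par u) k)

leafCount : ∀ {n} → Fin n → (Fin n → Fin n) → ℕ
leafCount {n} r par = length (filterᵇ isLeaf (allFin n))
  where
  isChildOf : Fin n → Fin n → Bool
  isChildOf u w = not ⌊ w ≟ r ⌋ ∧ ⌊ par w ≟ u ⌋
  isLeaf : Fin n → Bool
  isLeaf u = not (any (isChildOf u) (allFin n))

-- Let r be a gp-vertex, lying in a gp-set S, and fix a BFS tree rooted at r.
-- Below every vertex x of S other than r pick a leaf L of the tree. The tree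
-- path from L up to r is a geodesic of G through every ancestor of L, so two
-- distinct x, y ∈ S ∖ {r} with the same leaf would lie on a geodesic together
-- with r. Hence x ↦ L is injective on S ∖ {r}, and gp(G) = ∣ S ∣ ≤ 1 + ℓ(r).
module Submission where

open import Defs hiding (sym)
open import Data.Nat using (ℕ; zero; suc; _≤_; _<_; _+_; _∸_; z≤n; s≤s; _≤?_)
open import Data.Nat.Properties
  using (≤-antisym; ≤-trans; suc-injective; +-suc; ≰⇒>; <⇒≢; <⇒≱; m≤m+n; ∸-cancelˡ-≡; m+[n∸m]≡n)
open import Data.Fin using (Fin; zero; suc; toℕ; _≟_)
open import Data.Fin.Properties using (pigeonhole; toℕ≤pred[n])
import Data.Fin.Properties as Fin
open import Data.Fin.Subset using (Subset; ∣_∣; inside; outside) renaming (_∈_ to _∈ₛ_)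
open import Data.Vec using ([]; _∷_; here; there)
open import Data.Bool using (Bool; true; false; T; not; _∧_)
open import Data.Bool.Properties using (T-∧)
open import Data.Bool.ListAction using (any)
open import Data.List using (List; []; _∷_; length; map; filterᵇ; allFin)
open import Data.List.Properties using (length-map; length-removeAt′)
open import Data.List.Relation.Unary.Any using (here; there; index; satisfied; _─_)
open import Data.List.Relation.Unary.Any.Properties using (any⁻)
open import Data.List.Relation.Unary.All using () renaming (lookup to All-lookup; tabulate to All-tabulate)
open import Data.List.Relation.Unary.AllPairs using ([]; _∷_)
open import Data.List.Relation.Unary.Unique.Propositional using (Unique)
open import Data.List.Relation.Unary.Unique.Propositional.Properties using (map⁺)
open import Data.List.Membership.Propositional using (_∈_)
open import Data.List.Membership.Propositional.Properties using (∈-map⁻; ∈-filter⁺; ∈-allFin)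
open import Data.Product using (Σ; _×_; ∃-syntax; _,_; proj₁; proj₂)
open import Function using (Equivalence; _∘_)
open import Relation.Nullary using (⌊_⌋; yes; no; contradiction)
open import Relation.Nullary.Decidable using (T?; toWitness; toWitnessFalse)
open import Relation.Binary.PropositionalEquality
  using (_≡_; _≢_; refl; sym; trans; cong; subst)

module _ {A : Set} where

  ∈-─⁺ : ∀ {x y : A} {ys} (x∈ys : x ∈ ys) → y ∈ ys → y ≢ x → y ∈ (ys ─ x∈ys)
  ∈-─⁺ (here refl)  (here refl)  y≢x = contradiction refl y≢x
  ∈-─⁺ (here refl)  (there y∈ys) _   = y∈ys
  ∈-─⁺ (there _)    (here y≡z)   _   = here y≡z
  ∈-─⁺ (there x∈ys) (there y∈ys) y≢x = there (∈-─⁺ x∈ys y∈ys y≢x)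

  length≤-injection : ∀ (f : A → A) {xs ys} → Unique xs →
    (∀ {x} → x ∈ xs → f x ∈ ys) →
    (∀ {x y} → x ∈ xs → y ∈ xs → f x ≡ f y → x ≡ y) →
    length xs ≤ length ys
  length≤-injection f {[]} _ _ _ = z≤n
  length≤-injection f {x ∷ xs} {ys} (x∉xs ∷ unique) into injective =
    subst (suc (length xs) ≤_) (sym (length-removeAt′ ys (index fx∈ys)))
      (s≤s (length≤-injection f unique into′ (λ p q → injective (there p) (there q))))
    where
    fx∈ys : f x ∈ ys
    fx∈ys = into (here refl)
    into′ : ∀ {y} → y ∈ xs → f y ∈ (ys ─ fx∈ys)
    into′ y∈xs = ∈-─⁺ fx∈ys (into (there y∈xs))
      (λ fy≡fx → All-lookup x∉xs y∈xs (sym (injective (there y∈xs) (here refl) fy≡fx)))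

elements : ∀ {n} → Subset n → List (Fin n)
elements []            = []
elements (inside  ∷ p) = zero ∷ map suc (elements p)
elements (outside ∷ p) = map suc (elements p)

∣p∣≡length-elements : ∀ {n} (p : Subset n) → ∣ p ∣ ≡ length (elements p)
∣p∣≡length-elements []            = refl
∣p∣≡length-elements (inside  ∷ p) = cong suc (trans (∣p∣≡length-elements p) (sym (length-map suc (elements p))))
∣p∣≡length-elements (outside ∷ p) = trans (∣p∣≡length-elements p) (sym (length-map suc (elements p)))

∈-elements⁻ : ∀ {n} (p : Subset n) {x} → x ∈ elements p → x ∈ₛ p
∈-elements⁻ (inside ∷ p) (here refl) = here
∈-elements⁻ (inside ∷ p) (there x∈) with ∈-map⁻ suc x∈
... | y , y∈ , refl = there (∈-elements⁻ p y∈)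
∈-elements⁻ (outside ∷ p) x∈ with ∈-map⁻ suc x∈
... | y , y∈ , refl = there (∈-elements⁻ p y∈)

elements-unique : ∀ {n} (p : Subset n) → Unique (elements p)
elements-unique []            = []
elements-unique (inside  ∷ p) = All-tabulate zero∉ ∷ map⁺ Fin.suc-injective (elements-unique p)
  where
  zero∉ : ∀ {y} → y ∈ map suc (elements p) → zero ≢ y
  zero∉ y∈ with ∈-map⁻ suc y∈
  ... | _ , _ , refl = λ ()
elements-unique (outside ∷ p) = map⁺ Fin.suc-injective (elements-unique p)

∣p∣≤length-injection : ∀ {n} (p : Subset n) (f : Fin n → Fin n) {ys} →
  (∀ {x} → x ∈ₛ p → f x ∈ ys) →
  (∀ {x y} → x ∈ₛ p → y ∈ₛ p → f x ≡ f y → x ≡ y) →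
  ∣ p ∣ ≤ length ys
∣p∣≤length-injection p f into injective =
  subst (_≤ _) (sym (∣p∣≡length-elements p))
    (length≤-injection f (elements-unique p)
      (λ x∈ → into (∈-elements⁻ p x∈))
      (λ x∈ y∈ → injective (∈-elements⁻ p x∈) (∈-elements⁻ p y∈)))

module _ {n : ℕ} (G : Graph n) where

  dist-unique : ∀ {a b k k′} → Dist G a b k → Dist G a b k′ → k ≡ k′
  dist-unique (p , p-min) (q , q-min) = ≤-antisym (p-min _ q) (q-min _ p)

  snoc : ∀ {a b c k} → Walk G a b k → Adj G b c → Walk G a c (suc k)
  snoc stop        e = step e stop
  snoc (step e′ p) e = step e′ (snoc p e)

  reverse : ∀ {a b k} → Walk G a b k → Walk G b a k
  reverse stop       = stop
  reverse (step e p) = snoc (reverse p) (Graph.sym G e)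

  dist-sym : ∀ {a b k} → Dist G a b k → Dist G b a k
  dist-sym (p , p-min) = reverse p , λ m q → p-min m (reverse q)

  onWalk-end : ∀ {a b k} (p : Walk G a b k) → OnWalk G b p
  onWalk-end stop       = here
  onWalk-end (step _ p) = there (onWalk-end p)

module BFSTree {n : ℕ} (G : Graph n) (r : Fin n) (par : Fin n → Fin n)
               (bfs : IsBFSTree G r par) where

  dist-from-root : ∀ u → ∃[ d ] Dist G r u d
  dist-from-root u with u ≟ r
  ... | yes refl = 0 , stop , λ _ _ → z≤n
  ... | no u≢r with bfs u u≢r
  ...   | _ , k , du , _ = suc k , du

  dist-suc⇒≢root : ∀ {u k} → Dist G r u (suc k) → u ≢ r
  dist-suc⇒≢root (_ , minimal) refl with minimal 0 stop
  ... | ()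

  dist-parent : ∀ {u k} → Dist G r u (suc k) → Dist G r (par u) k
  dist-parent {u} du with bfs u (dist-suc⇒≢root du)
  ... | _ , _ , du′ , dp = subst (Dist G r (par u)) (suc-injective (dist-unique G du′ du)) dp

  dist-child : ∀ {c k} → c ≢ r → Dist G r (par c) k → Dist G r c (suc k)
  dist-child {c} c≢r dp with bfs c c≢r
  ... | _ , _ , dc , dp′ = subst (Dist G r c) (cong suc (dist-unique G dp′ dp)) dc

  ancestor : ℕ → Fin n → Fin n
  ancestor zero    u = u
  ancestor (suc i) u = ancestor i (par u)

  dist-ancestor : ∀ i {u k} → Dist G r u (i + k) → Dist G r (ancestor i u) k
  dist-ancestor zero    du = du
  dist-ancestor (suc i) du = dist-ancestor i (dist-parent du)

  -- The ancestors of u at heights 0, …, d have distinct distances from r,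
  -- so they are d + 1 distinct vertices.
  dist-from-root<n : ∀ {u d} → Dist G r u d → d < n
  dist-from-root<n {u} {d} du with n ≤? d
  ... | no n≰d = ≰⇒> n≰d
  ... | yes n≤d with pigeonhole (s≤s n≤d) (λ i → ancestor (toℕ i) u)
  ... | i , j , i<j , same =
    contradiction (∸-cancelˡ-≡ (toℕ≤pred[n] i) (toℕ≤pred[n] j) (dist-unique G di dj)) (<⇒≢ i<j)
    where
    dist-ancestor′ : ∀ {h} → h ≤ d → Dist G r (ancestor h u) (d ∸ h)
    dist-ancestor′ {h} h≤d = dist-ancestor h (subst (Dist G r u) (sym (m+[n∸m]≡n h≤d)) du)
    di : Dist G r (ancestor (toℕ i) u) (d ∸ toℕ i)
    di = dist-ancestor′ (toℕ≤pred[n] i)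
    dj : Dist G r (ancestor (toℕ i) u) (d ∸ toℕ j)
    dj = subst (λ w → Dist G r w (d ∸ toℕ j)) (sym same) (dist-ancestor′ (toℕ≤pred[n] j))

  data OnTreePath (x : Fin n) : Fin n → Set where
    start : OnTreePath x x
    climb : ∀ {u} → u ≢ r → OnTreePath x (par u) → OnTreePath x u

  onTreePath-trans : ∀ {x u w} → OnTreePath x u → OnTreePath u w → OnTreePath x w
  onTreePath-trans x-u start           = x-u
  onTreePath-trans x-u (climb w≢r u-w) = climb w≢r (onTreePath-trans x-u u-w)

  onTreePath-root : ∀ {x} → OnTreePath x r → x ≡ r
  onTreePath-root start           = refl
  onTreePath-root (climb r≢r _) = contradiction refl r≢r

  treePath : ∀ {u k} → Dist G r u k →
    Σ (Walk G u r k) λ W → ∀ {x} → OnTreePath x u → OnWalk G x W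
  treePath {k = zero} (stop , _) = stop , onStop
    where
    onStop : ∀ {x} → OnTreePath x r → OnWalk G x stop
    onStop start           = here
    onStop (climb r≢r _) = contradiction refl r≢r
  treePath {u} {suc k} du with treePath (dist-parent du)
  ... | W , onW = step (proj₁ (bfs u (dist-suc⇒≢root du))) W , onStep
    where
    onStep : ∀ {x} → OnTreePath x u → OnWalk G x (step _ W)
    onStep start         = here
    onStep (climb _ x-p) = there (onW x-p)

  onTreePath-geodesic : ∀ {x y L} → OnTreePath x L → OnTreePath y L → OnCommonGeodesic G r x y
  onTreePath-geodesic {L = L} x-L y-L with dist-from-root L
  ... | m , dL with treePath dL
  ... | W , onW = L , r , m , W , dist-sym G dL , onWalk-end G W , onW x-L , onW y-L

  -- The local definitions of leafCount, so that leafCount r par is length leaves.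
  isChildOf : Fin n → Fin n → Bool
  isChildOf u w = not ⌊ w ≟ r ⌋ ∧ ⌊ par w ≟ u ⌋

  isLeaf : Fin n → Bool
  isLeaf u = not (any (isChildOf u) (allFin n))

  leaves : List (Fin n)
  leaves = filterᵇ isLeaf (allFin n)

  child : ∀ {u} → T (any (isChildOf u) (allFin n)) → ∃[ c ] (c ≢ r × par c ≡ u)
  child {u} hasChild with satisfied (any⁻ (isChildOf u) (allFin n) hasChild)
  ... | c , isChild with Equivalence.to (T-∧ {not ⌊ c ≟ r ⌋}) isChild
  ... | c≢r , pc≡u = c , toWitnessFalse {a? = c ≟ r} c≢r , toWitness {a? = par c ≟ u} pc≡u

  -- The fuel suffices because distances from r stay below n along the descent.
  descend : ∀ fuel {u d} → Dist G r u d → n ≤ fuel + d →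
    ∃[ L ] (T (isLeaf L) × OnTreePath u L)
  descend zero du n≤d = contradiction n≤d (<⇒≱ (dist-from-root<n du))
  descend (suc fuel) {u} {d} du n≤fuel+d with any (isChildOf u) (allFin n) in hasChild?
  ... | false = u , subst (λ b → T (not b)) (sym hasChild?) _ , start
  ... | true with child (subst T (sym hasChild?) _)
  ... | c , c≢r , refl
    with descend fuel (dist-child c≢r du) (subst (n ≤_) (sym (+-suc fuel d)) n≤fuel+d)
  ... | L , leaf , c-L = L , leaf , onTreePath-trans (climb c≢r start) c-L

  leafBelow : ∀ u → ∃[ L ] (T (isLeaf L) × OnTreePath u L)
  leafBelow u = descend n (proj₂ (dist-from-root u)) (m≤m+n n _)

  leafOf : Fin n → Fin n
  leafOf u = proj₁ (leafBelow u)

  leafOf∈leaves : ∀ u → leafOf u ∈ leaves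
  leafOf∈leaves u = ∈-filter⁺ (λ w → T? (isLeaf w)) (∈-allFin (leafOf u)) (proj₁ (proj₂ (leafBelow u)))

  onTreePath-leafOf : ∀ u → OnTreePath u (leafOf u)
  onTreePath-leafOf u = proj₂ (proj₂ (leafBelow u))

  leafOf≢root : ∀ {u} → u ≢ r → leafOf u ≢ r
  leafOf≢root {u} u≢r L≡r = u≢r (onTreePath-root (subst (OnTreePath u) L≡r (onTreePath-leafOf u)))

  leafOrRoot : Fin n → Fin n
  leafOrRoot u with u ≟ r
  ... | yes _ = r
  ... | no _  = leafOf u

  leafOrRoot∈ : ∀ u → leafOrRoot u ∈ r ∷ leaves
  leafOrRoot∈ u with u ≟ r
  ... | yes _ = here refl
  ... | no _  = there (leafOf∈leaves u)

  module _ {S : Subset n} (gp : GeneralPosition G S) (r∈S : r ∈ₛ S) where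

    leafOf-injective : ∀ {x y} → x ∈ₛ S → y ∈ₛ S → x ≢ r → y ≢ r → leafOf x ≡ leafOf y → x ≡ y
    leafOf-injective {x} {y} x∈S y∈S x≢r y≢r same with x ≟ y
    ... | yes x≡y = x≡y
    ... | no x≢y  = contradiction onGeodesic
      (gp r x y r∈S x∈S y∈S (x≢r ∘ sym) x≢y (y≢r ∘ sym))
      where
      onGeodesic : OnCommonGeodesic G r x y
      onGeodesic = onTreePath-geodesic (onTreePath-leafOf x)
        (subst (OnTreePath y) (sym same) (onTreePath-leafOf y))

    leafOrRoot-injective : ∀ {x y} → x ∈ₛ S → y ∈ₛ S → leafOrRoot x ≡ leafOrRoot y → x ≡ y
    leafOrRoot-injective {x} {y} x∈S y∈S same with x ≟ r | y ≟ r
    ... | yes x≡r | yes y≡r = trans x≡r (sym y≡r)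
    ... | yes _   | no y≢r  = contradiction (sym same) (leafOf≢root y≢r)
    ... | no x≢r  | yes _   = contradiction same (leafOf≢root x≢r)
    ... | no x≢r  | no y≢r  = leafOf-injective x∈S y∈S x≢r y≢r same

    ∣S∣≤1+leafCount : ∣ S ∣ ≤ suc (leafCount r par)
    ∣S∣≤1+leafCount =
      ∣p∣≤length-injection S leafOrRoot (λ {u} _ → leafOrRoot∈ u) leafOrRoot-injective

corollary3p4 : ∀ {n} (G : Graph n) → Connected G →
    (S : Subset n) → IsGpSet G S →
    (v : Fin n) → IsGpVertex G v →
    (par : Fin n → Fin n) → IsBFSTree G v par →
    ∣ S ∣ ≤ suc (leafCount v par)
corollary3p4 G _ S (gpS , _) v (S′ , (gpS′ , maximum) , v∈S′) par bfs =
  ≤-trans (maximum S gpS) (BFSTree.∣S∣≤1+leafCount G v par bfs gpS′ v∈S′)
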